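{- Let $S=(X,\iota(X),\tau(X,X'))$ be an array-based transition system over $A^E_I$, $\mathcal{P}$ a finite set of index predicates, and $\hat{S}_{\mathcal{P}}$ its indexed predicate abstraction. For any formulas $F$ and $\psi$ over the abstract vocabulary $\Sigma_I\cup X_{\mathcal{P}}$, the formulas $$AbsRelInd(F,\tau,\psi,\mathcal{P}):=F(X_{\mathcal{P}})\wedge\psi(X_{\mathcal{P}})\wedge H_{\mathcal{P}}(X_{\mathcal{P}},X)\wedge EQ_{\mathcal{P}}(X,\bar X)\wedge\tau(\bar X,\bar X')\wedge EQ_{\mathcal{P}}(\bar X',X')\wedge\neg\psi(X'_{\mathcal{P}})\wedge H_{\mathcal{P}}(X'_{\mathcal{P}},X')$$ (where $X,\bar X,\bar X',X'$ are four distinct copies of the state variables) and $$F(X_{\mathcal{P}})\wedge\hat{\tau}(X_{\mathcal{P}},X'_{\mathcal{P}})\wedge\psi(X_{\mathcal{P}})\wedge\neg\psi(X'_{\mathcal{P}})$$ are equisatisfiable (modulo $A^E_I$).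
   Context: Fix an index theory $\mathcal{T}_I=(\Sigma_I,\mathcal{C}_I)$ all of whose models have finite universes, and a quantifier-free element theory $\mathcal{T}_E$. $A^E_I$ is the combination of $\mathcal{T}_I$, $\mathcal{T}_E$ and an array theory whose only symbol $\cdot[\cdot]$ is function application: array symbols are interpreted as total functions from the index universe to the element universe. An array-based transition system is $S=(X,\iota(X),\tau(X,X'))$ with $X$ a set of array-sorted symbols and $\iota,\tau$ formulas whose quantified variables are only of index sort. Index predicate abstraction: fix index variables $I=\{i_1,\dots,i_k\}$ and a finite set $\mathcal{P}(I)$ of $\Sigma(I)$-atoms $p(I,X)$. For each $p\in\mathcal{P}$ introduce a fresh predicate $x_p$ over the index sort of arity the number of free index variables of $p$; $X_{\mathcal{P}}$ is the set of these (and $X'_{\mathcal{P}}$ a primed copy). $H_{\mathcal{P}}(X_{\mathcal{P}},X):=\forall I.\bigwedge_{p\in\mathcal{P}}(x_p(I)\leftrightarrow p(I,X))$ and $EQ_{\mathcal{P}}(X,Y):=\forall I.\bigwedge_{p\in\mathcal{P}}(p(I,X)\leftrightarrow p(I,Y))$. The abstract transition formula is $\hat{\tau}(X_{\mathcal{P}},X'_{\mathcal{P}}):=\exists X,X'.(\tau(X,X')\wedge H_{\mathcal{P}}(X_{\mathcal{P}},X)\wedge H_{\mathcal{P}}(X'_{\mathcal{P}},X'))$, and similarly $\hat\iota:=\exists X.(\iota(X)\wedge H_{\mathcal{P}}(X_{\mathcal{P}},X))$; $\hat{S}_{\mathcal{P}}=(X_{\mathcal{P}},\hat\iota,\hat\tau)$.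 -}

module Defs where

open import Level using (Level)
open import Data.Nat using (ℕ)
open import Data.Fin using (Fin)
open import Data.Bool using (Bool)
open import Data.Product using (Σ; Σ-syntax; _×_)
open import Relation.Nullary using (¬_)
open import Relation.Binary.PropositionalEquality using (_≡_)
open import Function.Bundles using (_↔_)

-- Semantic (shallow) rendering of a theory: a notion of structure on a
-- carrier set, together with the class of structures that are models.
record Theory : Set₂ where
  field
    Str : Set → Set₁
    Mod : {A : Set} → Str A → Set

record IndexTheory : Set₂ where
  field
    theory : Theory
  open Theory theory public
  field
    finite : {A : Set} {s : Str A} → Mod s → Σ[ n ∈ ℕ ] (A ↔ Fin n)

-- A model of A^E_I: an index model of T_I and an element model of T_E.
-- Arrays are interpreted as total functions Idx → Elt.
record Model (TI : IndexTheory) (TE : Theory) : Set₁ where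
  field
    Idx    : Set
    idxStr : IndexTheory.Str TI Idx
    idxMod : IndexTheory.Mod TI idxStr
    Elt    : Set
    eltStr : Theory.Str TE Elt
    eltMod : Theory.Mod TE eltStr
open Model public

-- A valuation of the m array-sorted state variables X = {x_0,…,x_{m-1}}.
State : {TI : IndexTheory} {TE : Theory} → Model TI TE → ℕ → Set
State M m = Fin m → Idx M → Elt M

-- Array-based transition system S = (X, ι(X), τ(X,X')) with |X| = m;
-- ι and τ are given by their semantics in every model of A^E_I.
record ATS (TI : IndexTheory) (TE : Theory) (m : ℕ) : Set₁ where
  field
    ι : (M : Model TI TE) → State M m → Set
    τ : (M : Model TI TE) → State M m → State M m → Set
open ATS public

-- A finite set P of index predicates p(I,X), P = {p_0,…,p_{np-1}};
-- p_q has ar q free index variables; its truth value in a model is given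
-- for every assignment of its free index variables and every state.
record IndexPreds (TI : IndexTheory) (TE : Theory) (m : ℕ) : Set₁ where
  field
    np   : ℕ
    ar   : Fin np → ℕ
    atom : (q : Fin np) (M : Model TI TE) → (Fin (ar q) → Idx M) → State M m → Bool
open IndexPreds public

module _ {TI : IndexTheory} {TE : Theory} {m : ℕ} where

  -- Interpretation of the abstract predicate symbols X_P = {x_p} over an
  -- index universe A (x_p has arity ar p).
  AbsState : IndexPreds TI TE m → Set → Set
  AbsState P A = (q : Fin (np P)) → (Fin (ar P q) → A) → Bool

  -- A formula over the abstract vocabulary Σ_I ∪ X_P, given by its semantics.
  AbsFormula : IndexPreds TI TE m → Set₁
  AbsFormula P = {A : Set} → IndexTheory.Str TI A → AbsState P A → Set

  H : (P : IndexPreds TI TE m) (M : Model TI TE) → AbsState P (Idx M) → State M m → Set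
  H P M xp X = (q : Fin (np P)) (a : Fin (ar P q) → Idx M) → xp q a ≡ atom P q M a X

  EQ : (P : IndexPreds TI TE m) (M : Model TI TE) → State M m → State M m → Set
  EQ P M X Y = (q : Fin (np P)) (a : Fin (ar P q) → Idx M) → atom P q M a X ≡ atom P q M a Y

  τ̂ : (S : ATS TI TE m) (P : IndexPreds TI TE m) (M : Model TI TE) →
       AbsState P (Idx M) → AbsState P (Idx M) → Set
  τ̂ S P M xp xp' = Σ[ X ∈ State M m ] Σ[ X' ∈ State M m ]
                    (τ S M X X' × H P M xp X × H P M xp' X')

  ι̂ : (S : ATS TI TE m) (P : IndexPreds TI TE m) (M : Model TI TE) →
       AbsState P (Idx M) → Set
  ι̂ S P M xp = Σ[ X ∈ State M m ] (ι S M X × H P M xp X)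

  -- Satisfiability modulo A^E_I of AbsRelInd(F, τ, ψ, P): there is a model
  -- and values of the free symbols X_P, X'_P, X, X̄, X̄', X' making it true.
  SatAbsRelInd : ATS TI TE m → (P : IndexPreds TI TE m) → AbsFormula P → AbsFormula P → Set₁
  SatAbsRelInd S P F ψ =
    Σ[ M ∈ Model TI TE ] Σ[ xp ∈ AbsState P (Idx M) ] Σ[ xp' ∈ AbsState P (Idx M) ]
    Σ[ X ∈ State M m ] Σ[ Xb ∈ State M m ] Σ[ Xb' ∈ State M m ] Σ[ X' ∈ State M m ]
      ( F (idxStr M) xp × ψ (idxStr M) xp × H P M xp X × EQ P M X Xb
      × τ S M Xb Xb' × EQ P M Xb' X' × ¬ ψ (idxStr M) xp' × H P M xp' X')

  SatAbsStep : ATS TI TE m → (P : IndexPreds TI TE m) → AbsFormula P → AbsFormula P → Set₁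
  SatAbsStep S P F ψ =
    Σ[ M ∈ Model TI TE ] Σ[ xp ∈ AbsState P (Idx M) ] Σ[ xp' ∈ AbsState P (Idx M) ]
      ( F (idxStr M) xp × τ̂ S P M xp xp' × ψ (idxStr M) xp × ¬ ψ (idxStr M) xp')

{-# OPTIONS --safe #-}
module Submission where

-- H_P(X_P, X) fixes exactly the P-atoms of X, and EQ_P relates states with the
-- same P-atoms, so H_P is invariant under EQ_P.  Hence the middle copies X̄, X̄'
-- of a model of AbsRelInd already witness τ̂; conversely a witness of τ̂ gives a
-- model of AbsRelInd with X̄ = X and X̄' = X'.

open import Defs
open import Data.Nat using (ℕ)
open import Data.Product using (_,_)
open import Function.Bundles using (_⇔_; mk⇔)
open import Relation.Binary.PropositionalEquality using (refl; sym; trans)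

module _ {TI : IndexTheory} {TE : Theory} {m : ℕ}
         (P : IndexPreds TI TE m) (M : Model TI TE) where

  EQ-refl : (X : State M m) → EQ P M X X
  EQ-refl X q a = refl

  EQ-sym : {X Y : State M m} → EQ P M X Y → EQ P M Y X
  EQ-sym X≈Y q a = sym (X≈Y q a)

  H-resp-EQ : {xp : AbsState P (Idx M)} {X Y : State M m} →
              H P M xp X → EQ P M X Y → H P M xp Y
  H-resp-EQ xp≈X X≈Y q a = trans (xp≈X q a) (X≈Y q a)

module _ {TI : IndexTheory} {TE : Theory} {m : ℕ}
         (S : ATS TI TE m) (P : IndexPreds TI TE m) (F ψ : AbsFormula P) where

  satAbsRelInd⇒satAbsStep : SatAbsRelInd S P F ψ → SatAbsStep S P F ψ
  satAbsRelInd⇒satAbsStep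
    (M , xp , xp' , X , X̄ , X̄' , X' , Fxp , ψxp , H-X , X≈X̄ , τX̄X̄' , X̄'≈X' , ¬ψxp' , H-X') =
    M , xp , xp' , Fxp ,
    (X̄ , X̄' , τX̄X̄' , H-resp-EQ P M H-X X≈X̄ , H-resp-EQ P M H-X' (EQ-sym P M X̄'≈X')) ,
    ψxp , ¬ψxp'

  satAbsStep⇒satAbsRelInd : SatAbsStep S P F ψ → SatAbsRelInd S P F ψ
  satAbsStep⇒satAbsRelInd (M , xp , xp' , Fxp , (X , X' , τXX' , H-X , H-X') , ψxp , ¬ψxp') =
    M , xp , xp' , X , X , X' , X' , Fxp , ψxp , H-X , EQ-refl P M X , τXX' ,
    EQ-refl P M X' , ¬ψxp' , H-X'

mainTheorem2 : (TI : IndexTheory) (TE : Theory) (m : ℕ)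
    (S : ATS TI TE m) (P : IndexPreds TI TE m) (F ψ : AbsFormula P) →
    SatAbsRelInd S P F ψ ⇔ SatAbsStep S P F ψ
mainTheorem2 TI TE m S P F ψ =
  mk⇔ (satAbsRelInd⇒satAbsStep S P F ψ) (satAbsStep⇒satAbsRelInd S P F ψ)
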